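{- Let $G$ be a finite bipartite graph with nonempty partite sets $A$ and $B$. Suppose there exist distinct vertices $u,v\in B$ such that $N(u)\cap N(v)=\emptyset$ and no $A$-minimal set contains both $u$ and $v$. Then $$\sum_{\substack{S\subseteq B\\ N(S)=A}}(-1)^{|S|}=0.$$
   Context: For a vertex $w$, $N(w)$ is its set of neighbors; $N(W)=\bigcup_{w\in W}N(w)$. For $X\subseteq A$, a set $Y\subseteq B$ is $X$-minimal if $X\subseteq N(Y)$ but for every proper subset $Y'\subsetneq Y$, $X\not\subseteq N(Y')$. -}

module Defs where

open import Data.Nat using (ℕ; zero; suc)
open import Data.Bool using (Bool; true; false; if_then_else_)
open import Data.Fin using (Fin)
open import Data.Fin.Subset using (Subset; _∈_; _⊂_; ∣_∣; inside; outside)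
open import Data.Fin.Subset.Properties using (_∈?_)
open import Data.Fin.Properties using (any?; all?)
open import Data.List using (List; []; _∷_; map; _++_; foldr)
open import Data.Vec using ([]; _∷_)
open import Data.Integer using (ℤ; 0ℤ; -1ℤ; _+_; _^_)
open import Data.Product using (∃; _×_)
open import Relation.Binary.PropositionalEquality using (_≡_)
open import Relation.Nullary using (Dec; ¬_)
open import Relation.Nullary.Decidable using (⌊_⌋; _×-dec_)
open import Data.Bool.Properties using (_≟_)

-- A finite bipartite graph with partite sets A = Fin m and B = Fin n,
-- given by its bipartite adjacency: adj a b ≡ true iff a ∈ A and b ∈ B are adjacent.
BipGraph : ℕ → ℕ → Set
BipGraph m n = Fin m → Fin n → Bool

Adj : ∀ {m n} → BipGraph m n → Fin m → Fin n → Set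
Adj G a b = G a b ≡ true

InNbhd : ∀ {m n} → BipGraph m n → Subset n → Fin m → Set
InNbhd G Y a = ∃ λ b → b ∈ Y × Adj G a b

-- A ⊆ N(Y), i.e. N(Y) = A (as N(Y) ⊆ A always)
CoversA : ∀ {m n} → BipGraph m n → Subset n → Set
CoversA G Y = ∀ a → InNbhd G Y a

AMinimal : ∀ {m n} → BipGraph m n → Subset n → Set
AMinimal G Y = CoversA G Y × (∀ Y′ → Y′ ⊂ Y → ¬ CoversA G Y′)

coversA? : ∀ {m n} (G : BipGraph m n) (Y : Subset n) → Dec (CoversA G Y)
coversA? G Y = all? (λ a → any? (λ b → (b ∈? Y) ×-dec (G a b ≟ true)))

allSubsets : (n : ℕ) → List (Subset n)
allSubsets zero = [] ∷ []
allSubsets (suc n) = map (inside ∷_) (allSubsets n) ++ map (outside ∷_) (allSubsets n)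

sumℤ : List ℤ → ℤ
sumℤ = foldr _+_ 0ℤ

coverSignSum : ∀ {m n} → BipGraph m n → ℤ
coverSignSum {n = n} G =
  sumℤ (map (λ S → if ⌊ coversA? G S ⌋ then -1ℤ ^ ∣ S ∣ else 0ℤ) (allSubsets n))

module Submission where

-- Let F(S) be the summand of the cover sign sum: (-1)^|S| if
-- S ⊆ B covers A, and 0 otherwise.  For fixed S, F sums to 0 over the square of
-- four sets obtained by choosing whether u and v belong to S:
--   * being a cover is monotone, so the covering corners are up-closed;
--   * if S ∪ {u,v} covers, an A-minimal cover inside it misses u or v,
--     so S ∪ {u} or S ∪ {v} covers;
--   * if S ∪ {u} and S ∪ {v} cover, then S ∖ {u,v} covers, since no vertex of A
--     is adjacent to both u and v.
-- The covering patterns left are ∅, two adjacent corners, or the whole square,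
-- each of signed size 0.  Summing pairs {S ∪ {i}, S ∖ {i}} over all S counts
-- every subset twice (sumAll-pairUp), so the sum of the squares is four times
-- the cover sign sum, which therefore vanishes.

open import Defs
open import Data.Nat using (ℕ; suc; _≤_)
open import Data.Fin using (Fin; zero; suc)
open import Data.Fin.Properties using (any?)
open import Data.Fin.Subset using (Subset; inside; outside; _∈_; _∉_; _⊆_; _⊂_; _-_; ∣_∣)
open import Data.Fin.Subset.Properties using (_∈?_; ⊆-refl; ⊆-trans; ⊆-reflexive; p─q⊆p; x∈p⇒p-x⊂p; x∈p∧x≢y⇒x∈p-y)
open import Data.Fin.Subset.Induction using (Acc; acc; ⊂-wellFounded)
open import Data.Bool using (Bool; true; false; if_then_else_; _∧_; _∨_; f≤t; b≤b) renaming (_≤_ to _≤ᵇ_)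
open import Data.Bool.Properties using () renaming (_≟_ to _≟ᵇ_)
open import Data.Integer using (ℤ; 0ℤ; -1ℤ; +0; +[1+_]; -[1+_]; _+_; -_; _^_)
open import Data.Integer.Properties using (+-identityˡ; +-identityʳ; +-assoc; +-inverseˡ; +-inverseʳ; -1*i≡-i; neg-involutive; +-commutativeSemigroup)
open import Algebra.Properties.CommutativeSemigroup +-commutativeSemigroup using (interchange)
open import Data.List using (List; []; _∷_; map; _++_)
open import Data.List.Properties using (map-++; map-∘)
open import Data.Vec using (_∷_; _[_]≔_; here; there)
open import Data.Vec.Properties using ([]≔-commutes)
open import Data.Product using (Σ-syntax; _×_; _,_; proj₁)
open import Data.Sum using (_⊎_; inj₁; inj₂)
open import Data.Empty using (⊥-elim)
open import Function using (_∘_)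
open import Relation.Binary.PropositionalEquality using (_≡_; _≢_; refl; sym; trans; cong; cong₂; subst; module ≡-Reasoning)
open import Relation.Nullary using (¬_; Dec; yes; no)
open import Relation.Nullary.Decidable using (⌊_⌋; _×-dec_; _⊎-dec_)

open ≡-Reasoning

sumAll : (n : ℕ) → (Subset n → ℤ) → ℤ
sumAll n f = sumℤ (map f (allSubsets n))

sumℤ-++ : (xs ys : List ℤ) → sumℤ (xs ++ ys) ≡ sumℤ xs + sumℤ ys
sumℤ-++ [] ys = sym (+-identityˡ (sumℤ ys))
sumℤ-++ (x ∷ xs) ys = trans (cong (x +_) (sumℤ-++ xs ys)) (sym (+-assoc x (sumℤ xs) (sumℤ ys)))

sumℤ-map-+ : {A : Set} (f g : A → ℤ) (xs : List A) →
  sumℤ (map (λ a → f a + g a) xs) ≡ sumℤ (map f xs) + sumℤ (map g xs)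
sumℤ-map-+ f g [] = refl
sumℤ-map-+ f g (x ∷ xs) = trans (cong (f x + g x +_) (sumℤ-map-+ f g xs))
  (interchange (f x) (g x) (sumℤ (map f xs)) (sumℤ (map g xs)))

sumℤ-map-zero : {A : Set} (f : A → ℤ) (xs : List A) → (∀ a → f a ≡ 0ℤ) → sumℤ (map f xs) ≡ 0ℤ
sumℤ-map-zero f [] _ = refl
sumℤ-map-zero f (x ∷ xs) f≡0 = cong₂ _+_ (f≡0 x) (sumℤ-map-zero f xs f≡0)

sumAll-suc : (n : ℕ) (f : Subset (suc n) → ℤ) →
  sumAll (suc n) f ≡ sumAll n (λ S → f (inside ∷ S)) + sumAll n (λ S → f (outside ∷ S))
sumAll-suc n f = begin
  sumℤ (map f (map (inside ∷_) subsets ++ map (outside ∷_) subsets))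
    ≡⟨ cong sumℤ (map-++ f (map (inside ∷_) subsets) (map (outside ∷_) subsets)) ⟩
  sumℤ (map f (map (inside ∷_) subsets) ++ map f (map (outside ∷_) subsets))
    ≡⟨ sumℤ-++ (map f (map (inside ∷_) subsets)) (map f (map (outside ∷_) subsets)) ⟩
  sumℤ (map f (map (inside ∷_) subsets)) + sumℤ (map f (map (outside ∷_) subsets))
    ≡⟨ sym (cong₂ _+_ (cong sumℤ (map-∘ subsets)) (cong sumℤ (map-∘ subsets))) ⟩
  sumAll n (λ S → f (inside ∷ S)) + sumAll n (λ S → f (outside ∷ S)) ∎
  where subsets = allSubsets n

sumAll-+ : (n : ℕ) (f g : Subset n → ℤ) →
  sumAll n (λ S → f S + g S) ≡ sumAll n f + sumAll n g
sumAll-+ n f g = sumℤ-map-+ f g (allSubsets n)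

pairUp : {n : ℕ} → Fin n → (Subset n → ℤ) → Subset n → ℤ
pairUp i f S = f (S [ i ]≔ inside) + f (S [ i ]≔ outside)

sumAll-pairUp : {n : ℕ} (i : Fin n) (f : Subset n → ℤ) →
  sumAll n (pairUp i f) ≡ sumAll n f + sumAll n f
sumAll-pairUp {suc n} zero f = begin
  sumAll (suc n) (pairUp zero f)
    ≡⟨ sumAll-suc n (pairUp zero f) ⟩
  sumAll n g + sumAll n g
    ≡⟨ cong (λ t → t + t) (trans (sumAll-+ n _ _) (sym (sumAll-suc n f))) ⟩
  sumAll (suc n) f + sumAll (suc n) f ∎
  where
  g : Subset n → ℤ
  g S = f (inside ∷ S) + f (outside ∷ S)
sumAll-pairUp {suc n} (suc i) f = begin
  sumAll (suc n) (pairUp (suc i) f)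
    ≡⟨ sumAll-suc n (pairUp (suc i) f) ⟩
  sumAll n (pairUp i fᵢ) + sumAll n (pairUp i fₒ)
    ≡⟨ cong₂ _+_ (sumAll-pairUp i fᵢ) (sumAll-pairUp i fₒ) ⟩
  (sumAll n fᵢ + sumAll n fᵢ) + (sumAll n fₒ + sumAll n fₒ)
    ≡⟨ interchange (sumAll n fᵢ) (sumAll n fᵢ) (sumAll n fₒ) (sumAll n fₒ) ⟩
  (sumAll n fᵢ + sumAll n fₒ) + (sumAll n fᵢ + sumAll n fₒ)
    ≡⟨ cong (λ t → t + t) (sym (sumAll-suc n f)) ⟩
  sumAll (suc n) f + sumAll (suc n) f ∎
  where
  fᵢ fₒ : Subset n → ℤ
  fᵢ S = f (inside ∷ S)
  fₒ S = f (outside ∷ S)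

double≡0⇒≡0 : (x : ℤ) → x + x ≡ 0ℤ → x ≡ 0ℤ
double≡0⇒≡0 +0 _ = refl
double≡0⇒≡0 +[1+ n ] ()
double≡0⇒≡0 -[1+ n ] ()

sumAll-vanishes : {n : ℕ} (i : Fin n) (f : Subset n → ℤ) →
  (∀ S → pairUp i f S ≡ 0ℤ) → sumAll n f ≡ 0ℤ
sumAll-vanishes {n} i f pairs≡0 =
  double≡0⇒≡0 (sumAll n f) (trans (sym (sumAll-pairUp i f)) (sumℤ-map-zero _ (allSubsets n) pairs≡0))

∈-update-other : {n : ℕ} (S : Subset n) (i : Fin n) {x : Fin n} (b c : Bool) →
  x ≢ i → x ∈ S [ i ]≔ b → x ∈ S [ i ]≔ c
∈-update-other (_ ∷ S) zero b c x≢i here = ⊥-elim (x≢i refl)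
∈-update-other (_ ∷ S) zero b c x≢i (there x∈) = there x∈
∈-update-other (_ ∷ S) (suc i) b c x≢i here = here
∈-update-other (_ ∷ S) (suc i) b c x≢i (there x∈) = there (∈-update-other S i b c (x≢i ∘ cong suc) x∈)

⊆-update-other : {n : ℕ} {Y : Subset n} (S : Subset n) (i : Fin n) (b c : Bool) →
  Y ⊆ S [ i ]≔ b → i ∉ Y → Y ⊆ S [ i ]≔ c
⊆-update-other S i b c Y⊆ i∉Y x∈Y = ∈-update-other S i b c (λ { refl → i∉Y x∈Y }) (Y⊆ x∈Y)

update-grows : {n : ℕ} (S : Subset n) (i : Fin n) → S [ i ]≔ outside ⊆ S [ i ]≔ inside
update-grows (_ ∷ S) zero (there x∈) = there x∈
update-grows (_ ∷ S) (suc i) here = here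
update-grows (_ ∷ S) (suc i) (there x∈) = there (update-grows S i x∈)

∣update∣ : {n : ℕ} (S : Subset n) (i : Fin n) → ∣ S [ i ]≔ inside ∣ ≡ suc ∣ S [ i ]≔ outside ∣
∣update∣ (_ ∷ S) zero = refl
∣update∣ (true ∷ S) (suc i) = cong suc (∣update∣ S i)
∣update∣ (false ∷ S) (suc i) = ∣update∣ S i

sgn : {n : ℕ} → Subset n → ℤ
sgn S = -1ℤ ^ ∣ S ∣

sgn-flip : {n : ℕ} (S : Subset n) (i : Fin n) → sgn (S [ i ]≔ inside) ≡ - sgn (S [ i ]≔ outside)
sgn-flip S i = trans (cong (-1ℤ ^_) (∣update∣ S i)) (-1*i≡-i (sgn (S [ i ]≔ outside)))

ind : Bool → ℤ → ℤ
ind c s = if c then s else 0ℤ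

dec-≤ : {P Q : Set} (p : Dec P) (q : Dec Q) → (P → Q) → ⌊ p ⌋ ≤ᵇ ⌊ q ⌋
dec-≤ (no _) (no _) _ = b≤b
dec-≤ (no _) (yes _) _ = f≤t
dec-≤ (yes _) (yes _) _ = b≤b
dec-≤ (yes p) (no ¬q) P⇒Q = ⊥-elim (¬q (P⇒Q p))

dec-≤-∨ : {P Q R : Set} (p : Dec P) (q : Dec Q) (r : Dec R) → (P → Q ⊎ R) → ⌊ p ⌋ ≤ᵇ ⌊ q ⌋ ∨ ⌊ r ⌋
dec-≤-∨ p (yes q) r P⇒Q⊎R = dec-≤ p (yes q ⊎-dec r) P⇒Q⊎R
dec-≤-∨ p (no ¬q) (yes r) P⇒Q⊎R = dec-≤ p (no ¬q ⊎-dec yes r) P⇒Q⊎R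
dec-≤-∨ p (no ¬q) (no ¬r) P⇒Q⊎R = dec-≤ p (no ¬q ⊎-dec no ¬r) P⇒Q⊎R

dec-∧-≤ : {P Q R : Set} (p : Dec P) (q : Dec Q) (r : Dec R) → (P × Q → R) → ⌊ p ⌋ ∧ ⌊ q ⌋ ≤ᵇ ⌊ r ⌋
dec-∧-≤ (yes p) (yes q) r P×Q⇒R = dec-≤ (yes p ×-dec yes q) r P×Q⇒R
dec-∧-≤ (yes p) (no ¬q) r P×Q⇒R = dec-≤ (yes p ×-dec no ¬q) r P×Q⇒R
dec-∧-≤ (no ¬p) q r P×Q⇒R = dec-≤ (no ¬p ×-dec q) r P×Q⇒R

square-balanced : {c₁₁ c₀₁ c₁₀ c₀₀ : Bool} {s₁₁ s₀₁ s₁₀ : ℤ} (s : ℤ) →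
  s₁₁ ≡ s → s₀₁ ≡ - s → s₁₀ ≡ - s →
  c₀₀ ≤ᵇ c₁₀ → c₀₀ ≤ᵇ c₀₁ → c₁₀ ≤ᵇ c₁₁ → c₀₁ ≤ᵇ c₁₁ →
  c₁₁ ≤ᵇ c₁₀ ∨ c₀₁ → c₁₀ ∧ c₀₁ ≤ᵇ c₀₀ →
  (ind c₁₁ s₁₁ + ind c₀₁ s₀₁) + (ind c₁₀ s₁₀ + ind c₀₀ s) ≡ 0ℤ
square-balanced {false} {false} {false} {false} s refl refl refl _ _ _ _ _ _ = refl
square-balanced {true} {false} {false} {false} s refl refl refl _ _ _ _ () _
square-balanced {true} {true} {false} {false} s refl refl refl _ _ _ _ _ _ =
  trans (+-identityʳ (s + - s)) (+-inverseʳ s)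
square-balanced {true} {false} {true} {false} s refl refl refl _ _ _ _ _ _ =
  trans (cong₂ _+_ (+-identityʳ s) (+-identityʳ (- s))) (+-inverseʳ s)
square-balanced {true} {true} {true} {false} s refl refl refl _ _ _ _ _ ()
square-balanced {true} {true} {true} {true} s refl refl refl _ _ _ _ _ _ =
  cong₂ _+_ (+-inverseʳ s) (+-inverseˡ s)
square-balanced {false} {_} {true} {_} s refl refl refl _ _ () _ _ _
square-balanced {false} {true} {_} {_} s refl refl refl _ _ _ () _ _
square-balanced {_} {false} {_} {true} s refl refl refl _ () _ _ _ _
square-balanced {_} {_} {false} {true} s refl refl refl () _ _ _ _ _

module Covers {m n : ℕ} (G : BipGraph m n) where

  covers-mono : {S T : Subset n} → S ⊆ T → CoversA G S → CoversA G T
  covers-mono S⊆T cS a with cS a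
  ... | b , b∈S , a~b = b , S⊆T b∈S , a~b

  minimal-subcover : (S : Subset n) → CoversA G S → Σ[ Y ∈ Subset n ] Y ⊆ S × AMinimal G Y
  minimal-subcover S = go S (⊂-wellFounded S)
    where
    go : (S : Subset n) → Acc _⊂_ S → CoversA G S → Σ[ Y ∈ Subset n ] Y ⊆ S × AMinimal G Y
    go S (acc smaller) cS with any? (λ x → (x ∈? S) ×-dec coversA? G (S - x))
    ... | yes (x , x∈S , cS-x) with go (S - x) (smaller (x∈p⇒p-x⊂p x∈S)) cS-x
    ...   | Y , Y⊆S-x , minY = Y , ⊆-trans Y⊆S-x (p─q⊆p S _) , minY
    go S (acc _) cS | no noRemoval = S , ⊆-refl , cS , noProperCover
      where
      noProperCover : ∀ Y′ → Y′ ⊂ S → ¬ CoversA G Y′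
      noProperCover Y′ (Y′⊆S , x , x∈S , x∉Y′) cY′ =
        noRemoval (x , x∈S , covers-mono (λ y∈Y′ → x∈p∧x≢y⇒x∈p-y (Y′⊆S y∈Y′) (λ { refl → x∉Y′ y∈Y′ })) cY′)

  nbhd-update-other : (S : Subset n) (i : Fin n) (b c : Bool) {a : Fin m} →
    InNbhd G (S [ i ]≔ b) a → ¬ Adj G a i → InNbhd G (S [ i ]≔ c) a
  nbhd-update-other S i b c (x , x∈ , a~x) a≁i =
    x , ∈-update-other S i b c (λ { refl → a≁i a~x }) x∈ , a~x

module Square {m n : ℕ} (G : BipGraph m n) (u v : Fin n) (u≢v : u ≢ v)
  (disjoint : ∀ a → ¬ (Adj G a u × Adj G a v))
  (noMinimalBoth : ∀ Y → AMinimal G Y → ¬ (u ∈ Y × v ∈ Y)) where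

  open Covers G

  covers : Subset n → Bool
  covers T = ⌊ coversA? G T ⌋

  term : Subset n → ℤ
  term T = ind (covers T) (sgn T)

  corner : Subset n → Bool → Bool → Subset n
  corner S b c = S [ v ]≔ c [ u ]≔ b

  corner-swap : (S : Subset n) (b c : Bool) → corner S b c ≡ S [ u ]≔ b [ v ]≔ c
  corner-swap S b c = []≔-commutes S v u (u≢v ∘ sym)

  grow-u : (S : Subset n) (c : Bool) → corner S false c ⊆ corner S true c
  grow-u S c = update-grows (S [ v ]≔ c) u

  grow-v : (S : Subset n) (b : Bool) → corner S b false ⊆ corner S b true
  grow-v S b = ⊆-trans (⊆-reflexive (corner-swap S b false))
    (⊆-trans (update-grows (S [ u ]≔ b) v) (⊆-reflexive (sym (corner-swap S b true))))

  -- A minimal cover inside S ∪ {u,v} misses u or v.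
  split-cover : (S : Subset n) → CoversA G (corner S true true) →
    CoversA G (corner S true false) ⊎ CoversA G (corner S false true)
  split-cover S c₁₁ with minimal-subcover (corner S true true) c₁₁
  ... | Y , Y⊆ , minY with u ∈? Y
  ...   | no u∉Y = inj₂ (covers-mono (⊆-update-other (S [ v ]≔ true) u true false Y⊆ u∉Y) (proj₁ minY))
  ...   | yes u∈Y = inj₁ (covers-mono Y⊆₁₀ (proj₁ minY))
    where
    v∉Y : v ∉ Y
    v∉Y v∈Y = noMinimalBoth Y minY (u∈Y , v∈Y)
    Y⊆₁₀ : Y ⊆ corner S true false
    Y⊆₁₀ = ⊆-trans (⊆-update-other (S [ u ]≔ true) v true false (⊆-trans Y⊆ (⊆-reflexive (corner-swap S true true))) v∉Y)
      (⊆-reflexive (sym (corner-swap S true false)))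

  avoids : (a : Fin m) → ¬ Adj G a u ⊎ ¬ Adj G a v
  avoids a with G a u ≟ᵇ true
  ... | yes a~u = inj₂ (λ a~v → disjoint a (a~u , a~v))
  ... | no a≁u = inj₁ a≁u

  merge-covers : (S : Subset n) → CoversA G (corner S true false) → CoversA G (corner S false true) →
    CoversA G (corner S false false)
  merge-covers S c₁₀ c₀₁ a with avoids a
  ... | inj₁ a≁u = nbhd-update-other (S [ v ]≔ false) u true false (c₁₀ a) a≁u
  ... | inj₂ a≁v = subst (λ T → InNbhd G T a) (sym (corner-swap S false false))
    (nbhd-update-other (S [ u ]≔ false) v true false (subst (λ T → InNbhd G T a) (corner-swap S false true) (c₀₁ a)) a≁v)

  sgn₁₀ : (S : Subset n) → sgn (corner S true false) ≡ - sgn (corner S false false)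
  sgn₁₀ S = sgn-flip (S [ v ]≔ false) u

  sgn₀₁ : (S : Subset n) → sgn (corner S false true) ≡ - sgn (corner S false false)
  sgn₀₁ S = begin
    sgn (corner S false true)          ≡⟨ cong sgn (corner-swap S false true) ⟩
    sgn (S [ u ]≔ false [ v ]≔ true)   ≡⟨ sgn-flip (S [ u ]≔ false) v ⟩
    - sgn (S [ u ]≔ false [ v ]≔ false) ≡⟨ cong (-_ ∘ sgn) (sym (corner-swap S false false)) ⟩
    - sgn (corner S false false)        ∎

  sgn₁₁ : (S : Subset n) → sgn (corner S true true) ≡ sgn (corner S false false)
  sgn₁₁ S = begin
    sgn (corner S true true)          ≡⟨ sgn-flip (S [ v ]≔ true) u ⟩
    - sgn (corner S false true)        ≡⟨ cong -_ (sgn₀₁ S) ⟩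
    - - sgn (corner S false false)     ≡⟨ neg-involutive _ ⟩
    sgn (corner S false false)         ∎

  square-vanishes : (S : Subset n) → pairUp v (pairUp u term) S ≡ 0ℤ
  square-vanishes S = square-balanced (sgn (corner S false false)) (sgn₁₁ S) (sgn₀₁ S) (sgn₁₀ S)
    (dec-≤ d₀₀ d₁₀ (covers-mono (grow-u S false)))
    (dec-≤ d₀₀ d₀₁ (covers-mono (grow-v S false)))
    (dec-≤ d₁₀ d₁₁ (covers-mono (grow-v S true)))
    (dec-≤ d₀₁ d₁₁ (covers-mono (grow-u S true)))
    (dec-≤-∨ d₁₁ d₁₀ d₀₁ (split-cover S))
    (dec-∧-≤ d₁₀ d₀₁ d₀₀ (λ (c₁₀ , c₀₁) → merge-covers S c₁₀ c₀₁))
    where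
    d₁₁ = coversA? G (corner S true true)
    d₀₁ = coversA? G (corner S false true)
    d₁₀ = coversA? G (corner S true false)
    d₀₀ = coversA? G (corner S false false)

lemma4p11 : (m n : ℕ) → 1 ≤ m → 1 ≤ n → (G : BipGraph m n) → (u v : Fin n) → u ≢ v
    → (∀ a → ¬ (Adj G a u × Adj G a v))
    → (∀ Y → AMinimal G Y → ¬ (u ∈ Y × v ∈ Y))
    → coverSignSum G ≡ 0ℤ
lemma4p11 m n _ _ G u v u≢v disjoint noMinimalBoth = double≡0⇒≡0 (sumAll n term) (begin
  sumAll n term + sumAll n term    ≡⟨ sym (sumAll-pairUp u term) ⟩
  sumAll n (pairUp u term)         ≡⟨ sumAll-vanishes v (pairUp u term) square-vanishes ⟩
  0ℤ                               ∎)
  where open Square G u v u≢v disjoint noMinimalBoth
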